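{- For every integer $k\ge 3$, the set $2\mathbb{Z}^+\setminus\big(AP_0(\mathbf{t},k)\cap 2\mathbb{Z}^+\big)$ of even positive integers not in $AP_0(\mathbf{t},k)$ is unbounded.
   Context: The Thue–Morse word $\mathbf{t}=\mathbf{t}_1\mathbf{t}_2\mathbf{t}_3\cdots=0110100110010110\cdots$ is the infinite binary word whose $i$-th letter $\mathbf{t}_i$ ($i\ge 1$) is the parity of the number of 1's in the binary expansion of $i-1$. A $k$-anti-power is a word $w^{(1)}\cdots w^{(k)}$ with $w^{(1)},\dots,w^{(k)}$ pairwise distinct words of the same length. $AP_0(\mathbf{t},k)$ is the set of positive integers $m$ such that the prefix $\mathbf{t}_1\mathbf{t}_2\cdots\mathbf{t}_{km}$ is a $k$-anti-power. -}

module Defs where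

open import Data.Nat using (ℕ; zero; suc; _+_; _*_; _∸_; _<_; _≤_; _≥_)
open import Data.Nat.DivMod using (_/_; _%_)
open import Data.Bool using (Bool; true; false; _xor_)
open import Data.List using (List; map; upTo)
open import Data.Product using (Σ; _×_; ∃-syntax)
open import Relation.Binary.PropositionalEquality using (_≡_; _≢_)

-- Parity of the number of 1's in the binary expansion of n
-- (true = odd). Uses fuel (fuel ≥ n suffices, since n halves each step).
parityBitsFuel : ℕ → ℕ → Bool
parityBitsFuel zero    n = false
parityBitsFuel (suc f) zero = false
parityBitsFuel (suc f) n@(suc _) =
  (if-one (n % 2)) xor parityBitsFuel f (n / 2)
  where
  if-one : ℕ → Bool
  if-one 1 = true
  if-one _ = false

parityBits : ℕ → Bool
parityBits n = parityBitsFuel n n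

-- The Thue–Morse word, 1-indexed: t i = parity of popcount (i - 1), for i ≥ 1
-- (false = letter 0, true = letter 1).  t 0 is an irrelevant dummy.
t : ℕ → Bool
t i = parityBits (i ∸ 1)

factor : ℕ → ℕ → List Bool
factor a len = map (λ r → t (a + suc r)) (upTo len)

block : ℕ → ℕ → List Bool
block m j = factor (j * m) m

IsAntiPowerPrefix : ℕ → ℕ → Set
IsAntiPowerPrefix k m = ∀ i j → i < k → j < k → i ≢ j → block m i ≢ block m j

InAP0 : ℕ → ℕ → Set
InAP0 k m = 1 ≤ m × IsAntiPowerPrefix k m

module Submission where

-- Write τ(n) for the parity of the binary digit sum of n, so that the
-- Thue–Morse letters are t_{n+1} = τ(n).  For r < 2^a the number 2^a + r has
-- exactly one more 1-bit than r, hence  τ(2^a + r) = ¬ τ(r).  Applying this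
-- with both a and a + 1 gives  τ(2^a + r) = τ(2^{a+1} + r)  for r < 2^a,
-- i.e. the factors of length m = 2^a starting at positions m and 2m agree:
-- the blocks 1 and 2 of the prefix t_1 ⋯ t_{km} coincide.  For k ≥ 3 both
-- blocks occur, so m ∉ AP₀(t,k); taking m = 2^{N+1} gives arbitrarily large
-- even non-members.

open import Defs
open import Data.Nat using (ℕ; zero; suc; _+_; _*_; _^_; _<_; _≤_; _≥_; z≤n; s≤s; s≤s⁻¹)
open import Data.Nat.Properties
open import Data.Nat.DivMod
open import Data.Nat.Divisibility using (n∣m*n)
open import Data.Bool using (Bool; true; false; _xor_; not)
open import Data.List.Properties using (map-cong-local)
open import Data.List.Relation.Unary.All.Properties using (applyUpTo⁺₁)
open import Data.Product using (_×_; ∃-syntax; _,_)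
open import Relation.Nullary using (¬_)
open import Relation.Binary.PropositionalEquality
open ≡-Reasoning

oddBit : ℕ → Bool
oddBit 1 = true
oddBit _ = false

parityBitsFuel-unfold : ∀ f n →
  parityBitsFuel (suc f) (suc n) ≡ oddBit (suc n % 2) xor parityBitsFuel f (suc n / 2)
parityBitsFuel-unfold f n with suc n % 2
... | 0           = refl
... | 1           = refl
... | suc (suc _) = refl

-- Halving a positive number strictly decreases it; this is what makes any
-- fuel f ≥ n sufficient.
half-suc≤ : ∀ n → suc n / 2 ≤ n
half-suc≤ n = s≤s⁻¹ (m/n<m (suc n) 2 (s≤s (s≤s z≤n)))

parityBitsFuel-stable : ∀ f g n → n ≤ f → n ≤ g → parityBitsFuel f n ≡ parityBitsFuel g n
parityBitsFuel-stable zero    zero    zero    _       _       = refl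
parityBitsFuel-stable zero    (suc g) zero    _       _       = refl
parityBitsFuel-stable (suc f) zero    zero    _       _       = refl
parityBitsFuel-stable (suc f) (suc g) zero    _       _       = refl
parityBitsFuel-stable (suc f) (suc g) (suc n) (s≤s n≤f) (s≤s n≤g) = begin
    parityBitsFuel (suc f) (suc n)
  ≡⟨ parityBitsFuel-unfold f n ⟩
    oddBit (suc n % 2) xor parityBitsFuel f (suc n / 2)
  ≡⟨ cong (oddBit (suc n % 2) xor_) (parityBitsFuel-stable f g (suc n / 2)
       (≤-trans (half-suc≤ n) n≤f) (≤-trans (half-suc≤ n) n≤g)) ⟩
    oddBit (suc n % 2) xor parityBitsFuel g (suc n / 2)
  ≡⟨ parityBitsFuel-unfold g n ⟨
    parityBitsFuel (suc g) (suc n) ∎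

parityBits-step : ∀ n → parityBits n ≡ oddBit (n % 2) xor parityBits (n / 2)
parityBits-step zero    = refl
parityBits-step (suc n) = trans (parityBitsFuel-unfold n n)
  (cong (oddBit (suc n % 2) xor_)
        (parityBitsFuel-stable n (suc n / 2) (suc n / 2) (half-suc≤ n) ≤-refl))

parityBits-double+ : ∀ q r →
  parityBits (q * 2 + r) ≡ oddBit (r % 2) xor parityBits (q + r / 2)
parityBits-double+ q r = begin
    parityBits (q * 2 + r)
  ≡⟨ parityBits-step (q * 2 + r) ⟩
    oddBit ((q * 2 + r) % 2) xor parityBits ((q * 2 + r) / 2)
  ≡⟨ cong₂ (λ u v → oddBit u xor parityBits v) (%-remove-+ˡ r (n∣m*n q)) quotient ⟩
    oddBit (r % 2) xor parityBits (q + r / 2) ∎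
  where
  quotient : (q * 2 + r) / 2 ≡ q + r / 2
  quotient = trans (+-distrib-/-∣ˡ r (n∣m*n q)) (cong (_+ r / 2) (m*n/n≡m q 2))

xor-not : ∀ b c → b xor not c ≡ not (b xor c)
xor-not false c = refl
xor-not true  c = refl

-- High-bit flip: for r < 2^a, the number 2^a + r has one more 1-bit than r.
parityBits-flip : ∀ a r → r < 2 ^ a → parityBits (2 ^ a + r) ≡ not (parityBits r)
parityBits-flip zero    zero    _          = refl
parityBits-flip zero    (suc r) (s≤s ())
parityBits-flip (suc a) r       r<2^[1+a] = begin
    parityBits (2 ^ suc a + r)
  ≡⟨ cong (λ x → parityBits (x + r)) (*-comm 2 (2 ^ a)) ⟩
    parityBits (2 ^ a * 2 + r)
  ≡⟨ parityBits-double+ (2 ^ a) r ⟩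
    oddBit (r % 2) xor parityBits (2 ^ a + r / 2)
  ≡⟨ cong (oddBit (r % 2) xor_) (parityBits-flip a (r / 2) r/2<2^a) ⟩
    oddBit (r % 2) xor not (parityBits (r / 2))
  ≡⟨ xor-not (oddBit (r % 2)) (parityBits (r / 2)) ⟩
    not (oddBit (r % 2) xor parityBits (r / 2))
  ≡⟨ cong not (parityBits-step r) ⟨
    not (parityBits r) ∎
  where
  r/2<2^a : r / 2 < 2 ^ a
  r/2<2^a = m<n*o⇒m/o<n (subst (r <_) (*-comm 2 (2 ^ a)) r<2^[1+a])

block-letter : ∀ m j r → t (j * m + suc r) ≡ parityBits (j * m + r)
block-letter m j r = cong t (+-suc (j * m) r)

-- The factors of length 2^a starting at positions 2^a and 2^{a+1} coincide:
-- both are the complement of the prefix of length 2^a.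
block-repeat : ∀ a → block (2 ^ a) 1 ≡ block (2 ^ a) 2
block-repeat a = map-cong-local (applyUpTo⁺₁ (λ r → r) m same-letter)
  where
  m : ℕ
  m = 2 ^ a
  same-letter : ∀ {r} → r < m → t (1 * m + suc r) ≡ t (2 * m + suc r)
  same-letter {r} r<m = begin
      t (1 * m + suc r)
    ≡⟨ block-letter m 1 r ⟩
      parityBits (1 * m + r)
    ≡⟨ cong (λ x → parityBits (x + r)) (*-identityˡ m) ⟩
      parityBits (m + r)
    ≡⟨ parityBits-flip a r r<m ⟩
      not (parityBits r)
    ≡⟨ parityBits-flip (suc a) r (≤-trans r<m (m≤m+n m (m + 0))) ⟨
      parityBits (2 * m + r)
    ≡⟨ block-letter m 2 r ⟨
      t (2 * m + suc r) ∎

repeated-block⇒¬antiPower : ∀ {k m i j} → i < k → j < k → i ≢ j →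
  block m i ≡ block m j → ¬ InAP0 k m
repeated-block⇒¬antiPower i<k j<k i≢j same (_ , distinct) = distinct _ _ i<k j<k i≢j same

n<2^n : ∀ n → n < 2 ^ n
n<2^n zero    = s≤s z≤n
n<2^n (suc n) = ≤-trans (s≤s (n<2^n n)) (+-mono-≤ (m^n>0 2 n) (m≤m+n (2 ^ n) 0))

-- Every N is exceeded by the even number 2 · 2^N = 2^{N+1}, which is not in
-- AP₀(t,k) since its blocks 1 and 2 coincide.
mainTheorem5 : ∀ (k : ℕ) → k ≥ 3 → ∀ (N : ℕ) →
                 ∃[ n ] (N ≤ 2 * n × 1 ≤ n × ¬ InAP0 k (2 * n))
mainTheorem5 k k≥3 N =
  2 ^ N ,
  ≤-trans (n≤1+n N) (<⇒≤ (n<2^n (suc N))) ,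
  m^n>0 2 N ,
  repeated-block⇒¬antiPower {i = 1} {j = 2} (≤-trans (s≤s (s≤s z≤n)) k≥3) k≥3 (λ ())
    (block-repeat (suc N))
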